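{- Let $G$ be a finite simple graph with $m$ edges and let $e$ be an edge of $G$. Then the one-edge matching $M=\{e\}$ satisfies $d(M)=m$ if and only if $e$ is either a bond or a pendant edge of $G$.
   Context: The matching polytope $\mathcal{M}(G)$ is the convex hull of the incidence vectors $\chi_M\in\mathbb{R}^{E}$ of all matchings $M$ (sets of pairwise disjoint edges) of $G=(V,E)$; these are exactly its vertices. The skeleton $\mathcal{G}(\mathcal{M}(G))$ is the graph of vertices and edges (1-dimensional faces) of $\mathcal{M}(G)$, and $d(M)$ is the degree of $\chi_M$ in the skeleton. A pendant edge is an edge with an endpoint of degree $1$. An edge $uv$ is a bond if $d(u)=d(v)=2$ and $|N(u)\cap N(v)|=1$, where $d(\cdot)$ and $N(\cdot)$ are degree and neighborhood in $G$. -}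

module Defs where

open import Data.Nat using (ℕ)
open import Data.Bool using (if_then_else_)
open import Data.Fin using (Fin; _≟_)
open import Data.Fin.Properties using (any?)
open import Data.Fin.Subset using (Subset; _∈_)
open import Data.Vec using (lookup)
open import Data.List using (List; length; filter; allFin; foldr)
open import Data.List.Relation.Unary.Unique.Propositional using (Unique)
import Data.List.Membership.Propositional as LM
open import Data.Product using (_×_; _,_; proj₁; proj₂; ∃; Σ)
open import Data.Product.Properties using () 
open import Data.Sum using (_⊎_)
open import Relation.Nullary using (¬_; Dec)
open import Relation.Nullary.Decidable using (_×-dec_; _⊎-dec_)
open import Relation.Binary.PropositionalEquality using (_≡_; _≢_)
open import Data.Rational using (ℚ; 0ℚ; _+_; _≤_)
open import Function using (_⇔_)

SameEnds : ∀ {n} → Fin n × Fin n → Fin n × Fin n → Set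
SameEnds (a , b) (c , d) = (a ≡ c × b ≡ d) ⊎ (a ≡ d × b ≡ c)

record Graph (n m : ℕ) : Set where
  field
    ends   : Fin m → Fin n × Fin n
    noLoop : ∀ e → proj₁ (ends e) ≢ proj₂ (ends e)
    simple : ∀ e f → SameEnds (ends e) (ends f) → e ≡ f

module _ {n m : ℕ} (G : Graph n m) where
  open Graph G

  Incident : Fin n → Fin m → Set
  Incident v e = v ≡ proj₁ (ends e) ⊎ v ≡ proj₂ (ends e)

  incident? : ∀ v e → Dec (Incident v e)
  incident? v e = (v ≟ proj₁ (ends e)) ⊎-dec (v ≟ proj₂ (ends e))

  deg : Fin n → ℕ
  deg v = length (filter (incident? v) (allFin m))

  Adj : Fin n → Fin n → Set
  Adj u w = ∃ λ e → SameEnds (ends e) (u , w)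

  adj? : ∀ u w → Dec (Adj u w)
  adj? u w = any? (λ e → sameEnds? (ends e) (u , w))
    where
    sameEnds? : (p q : Fin n × Fin n) → Dec (SameEnds p q)
    sameEnds? (a , b) (c , d) = ((a ≟ c) ×-dec (b ≟ d)) ⊎-dec ((a ≟ d) ×-dec (b ≟ c))

  commonNeighbours : Fin n → Fin n → ℕ
  commonNeighbours u v = length (filter (λ w → adj? u w ×-dec adj? v w) (allFin n))

  Pendant : Fin m → Set
  Pendant e = deg (proj₁ (ends e)) ≡ 1 ⊎ deg (proj₂ (ends e)) ≡ 1

  Bond : Fin m → Set
  Bond e = deg (proj₁ (ends e)) ≡ 2 × deg (proj₂ (ends e)) ≡ 2
           × commonNeighbours (proj₁ (ends e)) (proj₂ (ends e)) ≡ 1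

  -- A set of edges (as a subset of E = Fin m, i.e. its incidence vector χ_M ∈ {0,1}^E)
  -- is a matching if distinct edges in it share no endpoint.
  IsMatching : Subset m → Set
  IsMatching M = ∀ e f → e ∈ M → f ∈ M → e ≢ f → ∀ v → Incident v e → ¬ Incident v f

  -- linear functional c · χ_M for c ∈ ℚ^E
  weight : (Fin m → ℚ) → Subset m → ℚ
  weight c M = foldr (λ e acc → (if lookup M e then c e else 0ℚ) + acc) 0ℚ (allFin m)

  -- χ_M and χ_N (M ≠ N) span an edge (1-dimensional face) of the matching polytope:
  -- some linear functional c is maximised over the polytope exactly on the segment
  -- [χ_M, χ_N], i.e. among the vertices (matchings) exactly at M and N.
  SkeletonAdj : Subset m → Subset m → Set
  SkeletonAdj M N =
    IsMatching M × IsMatching N × M ≢ N ×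
    Σ (Fin m → ℚ) λ c →
      (∀ K → IsMatching K → weight c K ≤ weight c M) ×
      weight c N ≡ weight c M ×
      (∀ K → IsMatching K → weight c K ≡ weight c M → K ≡ M ⊎ K ≡ N)

  -- d(M) = k : the degree of χ_M in the skeleton is k, i.e. there is a duplicate-free
  -- list of length k consisting of exactly the skeleton-neighbours of χ_M.
  SkeletonDegree : Subset m → ℕ → Set
  SkeletonDegree M k = Σ (List (Subset m)) λ L →
    Unique L × length L ≡ k × (∀ N → (N LM.∈ L) ⇔ SkeletonAdj M N)

{-# OPTIONS --safe #-}
module Submission where

-- For every edge f, the one-edge matching {e} is adjacent in the skeleton to the "partner"
-- of f: ∅ if f = e, {f} if f meets e, and {e, f} if f is disjoint from e.  The m partners
-- are distinct, so d({e}) ≥ m always.  A neighbour N containing an edge x disjoint from e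
-- equals {e, x}: the matchings {e, x} and N ∖ {x} have the same total incidence vector as
-- {e} and N, which an edge of the polytope does not allow unless {e, x} is one of its ends.
-- So the remaining neighbours consist of edges meeting e, and the only ones that are not
-- partners are the pairs {x, y} of disjoint edges through the two different ends u, v of e
-- ("cross pairs"), which are always neighbours.  Finally, a cross pair exists exactly when
-- e is neither pendant nor a bond.  If e is not pendant, u and v carry further edges x and
-- y; if these meet, at w say, then a third edge at u would miss y and a third edge at v
-- would miss x, so otherwise d(u) = d(v) = 2 and w is the only common neighbour: e is a bond.
--
-- Every adjacency is certified by a linear functional that is -1 on the edges outside both
-- matchings and for which every matching is dominated, edge by edge, by one of the two.

open import Defs
open import Algebra using (CommutativeMonoid)
open import Data.Bool using (true; false; if_then_else_)
import Data.Bool.Properties as Bool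
open import Data.Fin using (Fin; zero; suc; _≟_)
open import Data.Fin.Properties using (any?)
open import Data.Fin.Subset using (Subset; _∈_; _∉_; _⊆_; ⁅_⁆; _∪_; _-_) renaming (⊥ to ∅)
open import Data.Fin.Subset.Properties
  using (_∈?_; x∈⁅x⁆; x∈⁅y⁆⇒x≡y; x∈⁅y⁆⇔x≡y; x≢y⇒x∉⁅y⁆; x∈p∪q⁻; p⊆p∪q; q⊆p∪q; p─q⊆p;
         x∈p∧x≢y⇒x∈p-y; ∉⊥; ⊆-antisym; nonempty?; Empty-unique)
open import Data.List using (List; []; _∷_; length; filter; allFin; foldr; map)
open import Data.List.Membership.Propositional using () renaming (_∈_ to _∈ₗ_)
open import Data.List.Membership.Propositional.Properties
  using (∈-filter⁺; ∈-filter⁻; ∈-allFin; ∈-map⁺; ∈-map⁻)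
open import Data.List.Properties using (filter-notAll; length-map; length-tabulate)
open import Data.List.Relation.Unary.All as All using (All; []; _∷_)
open import Data.List.Relation.Unary.Any as Any using (here; there)
open import Data.List.Relation.Unary.AllPairs using ([]; _∷_)
open import Data.List.Relation.Unary.Unique.Propositional using (Unique)
import Data.List.Relation.Unary.Unique.Propositional.Properties as Unique
open import Data.Nat using (ℕ; z≤n; s≤s) renaming (_≤_ to _≤ℕ_)
import Data.Nat.Properties as ℕ
open import Data.Product using (_×_; _,_; proj₁; proj₂; ∃; ∃₂)
open import Data.Rational using (ℚ; 0ℚ; 1ℚ; -_; _+_; _≤_; _<_)
open import Data.Rational.Properties
  using (≤-refl; ≤-reflexive; ≤-trans; ≤-antisym; <⇒≤; <-irrefl; ≮⇒≥; +-mono-≤; +-mono-<-≤;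
         +-mono-≤-<; +-comm; +-identityˡ; +-identityʳ; +-0-commutativeMonoid; positive⁻¹; negative⁻¹)
open import Algebra.Properties.CommutativeSemigroup
  (CommutativeMonoid.commutativeSemigroup +-0-commutativeMonoid) using (interchange)
import Data.Sum
open import Data.Sum using (_⊎_; inj₁; inj₂; [_,_]′)
import Data.Vec as Vec
open import Data.Vec using (lookup)
open import Data.Vec.Properties using ([]=⇒lookup; lookup⇒[]=; tabulate∘lookup; tabulate-cong; ≡-dec)
open import Function using (_∘_; id; _⇔_; mk⇔; Equivalence)
open import Relation.Binary.Definitions using (DecidableEquality)
open import Relation.Binary.PropositionalEquality
  using (_≡_; _≢_; refl; sym; trans; cong; cong₂; subst; ≢-sym; module ≡-Reasoning)
open import Relation.Nullary using (¬_; Dec; yes; no; ¬?; contradiction)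
open import Relation.Nullary.Decidable using (decidable-stable; _×-dec_; _⊎-dec_)
open import Relation.Unary using (Decidable)

-- Finite sums and counting

module _ {A : Set} where

  sumℚ : (A → ℚ) → List A → ℚ
  sumℚ f = foldr (λ i acc → f i + acc) 0ℚ

  sumℚ-cong : ∀ {f g : A → ℚ} → (∀ i → f i ≡ g i) → ∀ xs → sumℚ f xs ≡ sumℚ g xs
  sumℚ-cong f≗g []       = refl
  sumℚ-cong f≗g (x ∷ xs) = cong₂ _+_ (f≗g x) (sumℚ-cong f≗g xs)

  sumℚ-mono-≤ : ∀ {f g : A → ℚ} → (∀ i → f i ≤ g i) → ∀ xs → sumℚ f xs ≤ sumℚ g xs
  sumℚ-mono-≤ f≤g []       = ≤-refl
  sumℚ-mono-≤ f≤g (x ∷ xs) = +-mono-≤ (f≤g x) (sumℚ-mono-≤ f≤g xs)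

  sumℚ-mono-< : ∀ {f g : A → ℚ} {j} → (∀ i → f i ≤ g i) →
                ∀ xs → j ∈ₗ xs → f j < g j → sumℚ f xs < sumℚ g xs
  sumℚ-mono-< f≤g (x ∷ xs) (here refl)  fj<gj = +-mono-<-≤ fj<gj (sumℚ-mono-≤ f≤g xs)
  sumℚ-mono-< f≤g (x ∷ xs) (there j∈xs) fj<gj = +-mono-≤-< (f≤g x) (sumℚ-mono-< f≤g xs j∈xs fj<gj)

  sumℚ-mono-≤-≡⇒≡ : ∀ {f g : A → ℚ} {j} → (∀ i → f i ≤ g i) →
                    ∀ xs → sumℚ f xs ≡ sumℚ g xs → j ∈ₗ xs → f j ≡ g j
  sumℚ-mono-≤-≡⇒≡ f≤g xs eq j∈xs =
    ≤-antisym (f≤g _) (≮⇒≥ λ fj<gj → <-irrefl eq (sumℚ-mono-< f≤g xs j∈xs fj<gj))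

  sumℚ-+ : ∀ (f g : A → ℚ) xs → sumℚ (λ i → f i + g i) xs ≡ sumℚ f xs + sumℚ g xs
  sumℚ-+ f g []       = refl
  sumℚ-+ f g (x ∷ xs) =
    trans (cong (f x + g x +_) (sumℚ-+ f g xs)) (interchange (f x) (g x) (sumℚ f xs) (sumℚ g xs))

  sumℚ-zero : ∀ {f : A → ℚ} xs → All (λ i → f i ≡ 0ℚ) xs → sumℚ f xs ≡ 0ℚ
  sumℚ-zero []       []             = refl
  sumℚ-zero (x ∷ xs) (fx≡0 ∷ fxs≡0) = cong₂ _+_ fx≡0 (sumℚ-zero xs fxs≡0)

  sumℚ-δ : ∀ {f : A → ℚ} {j} xs → Unique xs → j ∈ₗ xs → (∀ i → i ≢ j → f i ≡ 0ℚ) → sumℚ f xs ≡ f j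
  sumℚ-δ {f} (x ∷ xs) (x∉xs ∷ _) (here refl) f0 =
    trans (cong (f x +_) (sumℚ-zero xs (All.map (f0 _ ∘ ≢-sym) x∉xs))) (+-identityʳ (f x))
  sumℚ-δ {f} {j} (x ∷ xs) (x∉xs ∷ !xs) (there j∈xs) f0 =
    trans (cong₂ _+_ (f0 x (All.lookup x∉xs j∈xs)) (sumℚ-δ xs !xs j∈xs f0)) (+-identityˡ (f j))

module _ {A : Set} (_≟ᴬ_ : DecidableEquality A) where

  Unique⇒length≤ : ∀ {xs ys : List A} → Unique xs → (∀ {x} → x ∈ₗ xs → x ∈ₗ ys) →
                   length xs ≤ℕ length ys
  Unique⇒length≤ {[]}     _            _     = z≤n
  Unique⇒length≤ {x ∷ xs} {ys} (x∉xs ∷ !xs) xs⊆ys = ℕ.≤-trans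
    (s≤s (Unique⇒length≤ !xs xs⊆ys-x))
    (filter-notAll ≢x? ys (Any.map (λ x≡y y≢x → y≢x (sym x≡y)) (xs⊆ys (here refl))))
    where
    ≢x? = λ y → ¬? (y ≟ᴬ x)
    xs⊆ys-x : ∀ {z} → z ∈ₗ xs → z ∈ₗ filter ≢x? ys
    xs⊆ys-x z∈xs = ∈-filter⁺ ≢x? (xs⊆ys (there z∈xs)) (≢-sym (All.lookup x∉xs z∈xs))

module _ {k : ℕ} {P : Fin k → Set} (P? : Decidable P) where

  count : ℕ
  count = length (filter P? (allFin k))

  count-≥ : ∀ {xs} → Unique xs → All P xs → length xs ≤ℕ count
  count-≥ !xs pxs = Unique⇒length≤ _≟_ !xs (λ x∈xs → ∈-filter⁺ P? (∈-allFin _) (All.lookup pxs x∈xs))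

  count-≤ : ∀ xs → (∀ i → P i → i ∈ₗ xs) → count ≤ℕ length xs
  count-≤ xs cover =
    Unique⇒length≤ _≟_ (Unique.filter⁺ P? {allFin k} (Unique.allFin⁺ k))
                       (λ i∈ → cover _ (proj₂ (∈-filter⁻ P? {xs = allFin k} i∈)))

  count-≡ : ∀ {xs} → Unique xs → All P xs → (∀ i → P i → i ∈ₗ xs) → count ≡ length xs
  count-≡ !xs pxs cover = ℕ.≤-antisym (count-≤ _ cover) (count-≥ !xs pxs)

  count≢0⇒∃ : count ≢ 0 → ∃ P
  count≢0⇒∃ count≢0 with any? P?
  ... | yes p = p
  ... | no ∄p = contradiction (ℕ.n≤0⇒n≡0 (count-≤ [] λ i pi → contradiction (i , pi) ∄p)) count≢0

-- Subsets of edges and linear functionals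

module _ {m : ℕ} where

  lookup-∉ : ∀ {K : Subset m} {i} → i ∉ K → lookup K i ≡ false
  lookup-∉ {K} {i} i∉K with lookup K i in eq
  ... | true  = contradiction (lookup⇒[]= i K eq) i∉K
  ... | false = refl

  lookup-∈∈ : ∀ {K L : Subset m} {i} → i ∈ K → i ∈ L → lookup K i ≡ lookup L i
  lookup-∈∈ i∈K i∈L = trans ([]=⇒lookup i∈K) (sym ([]=⇒lookup i∈L))

  lookup-∉∉ : ∀ {K L : Subset m} {i} → i ∉ K → i ∉ L → lookup K i ≡ lookup L i
  lookup-∉∉ i∉K i∉L = trans (lookup-∉ i∉K) (sym (lookup-∉ i∉L))

  lookup-≡ : ∀ {K L : Subset m} i → (i ∈ K → i ∈ L) → (i ∈ L → i ∈ K) → lookup K i ≡ lookup L i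
  lookup-≡ {K} {L} i K⇒L L⇒K with i ∈? K | i ∈? L
  ... | yes i∈K | yes i∈L = lookup-∈∈ i∈K i∈L
  ... | no  i∉K | no  i∉L = lookup-∉∉ i∉K i∉L
  ... | yes i∈K | no  i∉L = contradiction (K⇒L i∈K) i∉L
  ... | no  i∉K | yes i∈L = contradiction (L⇒K i∈L) i∉K

  Subset-ext : ∀ {K L : Subset m} → (∀ i → lookup K i ≡ lookup L i) → K ≡ L
  Subset-ext {K} {L} K≗L = trans (sym (tabulate∘lookup K)) (trans (tabulate-cong K≗L) (tabulate∘lookup L))

  ≡⁅⁆ : ∀ {N : Subset m} {x} → x ∈ N → (∀ {y} → y ∈ N → ¬ y ≢ x) → N ≡ ⁅ x ⁆
  ≡⁅⁆ {N} {x} x∈N others = ⊆-antisym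
    (λ {y} y∈N → Equivalence.from x∈⁅y⁆⇔x≡y (decidable-stable (y ≟ x) (others y∈N)))
    (λ y∈x → subst (_∈ N) (sym (x∈⁅y⁆⇒x≡y x y∈x)) x∈N)

x∉p-x : ∀ {m} (p : Subset m) x → x ∉ p - x
x∉p-x (_ Vec.∷ p) zero    ()
x∉p-x (_ Vec.∷ p) (suc x) (Vec.there x∈p-x) = x∉p-x p x x∈p-x

module _ {m : ℕ} (c : Fin m → ℚ) where

  term : Subset m → Fin m → ℚ
  term K i = if lookup K i then c i else 0ℚ

  term-∈ : ∀ {K i} → i ∈ K → term K i ≡ c i
  term-∈ i∈K rewrite []=⇒lookup i∈K = refl

  term-∉ : ∀ {K i} → i ∉ K → term K i ≡ 0ℚ
  term-∉ i∉K rewrite lookup-∉ i∉K = refl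

  data Dominates (K R : Subset m) (i : Fin m) : Set where
    agree : lookup K i ≡ lookup R i → Dominates K R i
    drop  : i ∉ R → c i < 0ℚ → Dominates K R i
    take  : i ∈ R → 0ℚ < c i → Dominates K R i

  dominates⇒term≤ : ∀ {K R i} → Dominates K R i → term K i ≤ term R i
  dominates⇒term≤ (agree K≡R) = ≤-reflexive (cong (λ b → if b then _ else 0ℚ) K≡R)
  dominates⇒term≤ {K} {i = i} (drop i∉R ci<0) rewrite term-∉ i∉R with i ∈? K
  ... | yes i∈K rewrite term-∈ i∈K = <⇒≤ ci<0
  ... | no  i∉K rewrite term-∉ i∉K = ≤-refl
  dominates⇒term≤ {K} {i = i} (take i∈R 0<ci) rewrite term-∈ i∈R with i ∈? K
  ... | yes i∈K rewrite term-∈ i∈K = ≤-refl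
  ... | no  i∉K rewrite term-∉ i∉K = <⇒≤ 0<ci

  dominates∧term≡⇒lookup≡ : ∀ {K R i} → Dominates K R i → term K i ≡ term R i → lookup K i ≡ lookup R i
  dominates∧term≡⇒lookup≡ (agree K≡R) _ = K≡R
  dominates∧term≡⇒lookup≡ {K} {i = i} (drop i∉R ci<0) eq with i ∈? K
  ... | yes i∈K = contradiction (trans (sym (term-∈ i∈K)) (trans eq (term-∉ i∉R))) λ ci≡0 → <-irrefl ci≡0 ci<0
  ... | no  i∉K = lookup-∉∉ i∉K i∉R
  dominates∧term≡⇒lookup≡ {K} {i = i} (take i∈R 0<ci) eq with i ∈? K
  ... | yes i∈K = lookup-∈∈ i∈K i∈R
  ... | no  i∉K = contradiction (trans (sym (term-∉ i∉K)) (trans eq (term-∈ i∈R))) λ 0≡ci → <-irrefl 0≡ci 0<ci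

module _ {m : ℕ} (A : Subset m) (a : ℚ) (B : Subset m) (b : ℚ) where

  layered : Fin m → ℚ
  layered i = if lookup A i then a else if lookup B i then b else - 1ℚ

  layered-∈₁ : ∀ {i} → i ∈ A → layered i ≡ a
  layered-∈₁ i∈A rewrite []=⇒lookup i∈A = refl

  layered-∈₂ : ∀ {i} → i ∉ A → i ∈ B → layered i ≡ b
  layered-∈₂ i∉A i∈B rewrite lookup-∉ i∉A | []=⇒lookup i∈B = refl

  layered-∉ : ∀ {i} → i ∉ A → i ∉ B → layered i < 0ℚ
  layered-∉ i∉A i∉B rewrite lookup-∉ i∉A | lookup-∉ i∉B = negative⁻¹ (- 1ℚ)

-- Graphs

module _ {n : ℕ} {a b : Fin n} (a≢b : a ≢ b) where

  pair-unique : ∀ {p q p′ q′} → a ≡ p ⊎ a ≡ q → b ≡ p ⊎ b ≡ q → a ≡ p′ ⊎ a ≡ q′ → b ≡ p′ ⊎ b ≡ q′ →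
                SameEnds (p , q) (p′ , q′)
  pair-unique (inj₁ refl) (inj₁ refl) _           _           = contradiction refl a≢b
  pair-unique (inj₂ refl) (inj₂ refl) _           _           = contradiction refl a≢b
  pair-unique _           _           (inj₁ refl) (inj₁ refl) = contradiction refl a≢b
  pair-unique _           _           (inj₂ refl) (inj₂ refl) = contradiction refl a≢b
  pair-unique (inj₁ refl) (inj₂ refl) (inj₁ refl) (inj₂ refl) = inj₁ (refl , refl)
  pair-unique (inj₁ refl) (inj₂ refl) (inj₂ refl) (inj₁ refl) = inj₂ (refl , refl)
  pair-unique (inj₂ refl) (inj₁ refl) (inj₁ refl) (inj₂ refl) = inj₂ (refl , refl)
  pair-unique (inj₂ refl) (inj₁ refl) (inj₂ refl) (inj₁ refl) = inj₁ (refl , refl)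

  pair-cases : ∀ {p q z} → a ≡ p ⊎ a ≡ q → b ≡ p ⊎ b ≡ q → z ≡ p ⊎ z ≡ q → z ≡ a ⊎ z ≡ b
  pair-cases (inj₁ refl) (inj₁ refl) _           = contradiction refl a≢b
  pair-cases (inj₂ refl) (inj₂ refl) _           = contradiction refl a≢b
  pair-cases (inj₁ refl) (inj₂ refl) (inj₁ refl) = inj₁ refl
  pair-cases (inj₁ refl) (inj₂ refl) (inj₂ refl) = inj₂ refl
  pair-cases (inj₂ refl) (inj₁ refl) (inj₁ refl) = inj₂ refl
  pair-cases (inj₂ refl) (inj₁ refl) (inj₂ refl) = inj₁ refl

module _ {n m : ℕ} (G : Graph n m) where

  open Graph G

  infix 4 _∈ₑ_
  _∈ₑ_ : Fin n → Fin m → Set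
  v ∈ₑ f = Incident G v f

  edge-unique : ∀ {a b f g} → a ≢ b → a ∈ₑ f → b ∈ₑ f → a ∈ₑ g → b ∈ₑ g → f ≡ g
  edge-unique a≢b af bf ag bg = simple _ _ (pair-unique a≢b af bf ag bg)

  end-cases : ∀ {a b z f} → a ≢ b → a ∈ₑ f → b ∈ₑ f → z ∈ₑ f → z ≡ a ⊎ z ≡ b
  end-cases a≢b = pair-cases a≢b

  Adj⇒edge : ∀ {a b} → Adj G a b → ∃ λ f → a ∈ₑ f × b ∈ₑ f
  Adj⇒edge (f , inj₁ (p≡a , q≡b)) = f , inj₁ (sym p≡a) , inj₂ (sym q≡b)
  Adj⇒edge (f , inj₂ (p≡b , q≡a)) = f , inj₂ (sym q≡a) , inj₁ (sym p≡b)

  Adj⇒≢ : ∀ {a b} → Adj G a b → a ≢ b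
  Adj⇒≢ (f , inj₁ (p≡a , q≡b)) a≡b = noLoop f (trans p≡a (trans a≡b (sym q≡b)))
  Adj⇒≢ (f , inj₂ (p≡b , q≡a)) a≡b = noLoop f (trans p≡b (trans (sym a≡b) (sym q≡a)))

  edge⇒Adj : ∀ {a b f} → a ≢ b → a ∈ₑ f → b ∈ₑ f → Adj G a b
  edge⇒Adj {f = f} a≢b af bf = f , pair-unique a≢b af bf (inj₁ refl) (inj₂ refl)

  ShareEnd : Fin m → Fin m → Set
  ShareEnd f g = ∃ λ v → v ∈ₑ f × v ∈ₑ g

  shareEnd? : ∀ f g → Dec (ShareEnd f g)
  shareEnd? f g with incident? G (proj₁ (ends f)) g | incident? G (proj₂ (ends f)) g
  ... | yes pg | _      = yes (_ , inj₁ refl , pg)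
  ... | no  _  | yes qg = yes (_ , inj₂ refl , qg)
  ... | no ¬pg | no ¬qg = no λ { (_ , inj₁ refl , pg) → ¬pg pg ; (_ , inj₂ refl , qg) → ¬qg qg }

  shareEnd-refl : ∀ f → ShareEnd f f
  shareEnd-refl f = _ , inj₁ refl , inj₁ refl

  shareEnd-sym : ∀ {f g} → ShareEnd f g → ShareEnd g f
  shareEnd-sym (v , vf , vg) = v , vg , vf

  shareEnd-end : ∀ {a b f g} → a ≢ b → a ∈ₑ g → b ∈ₑ g → ShareEnd f g → a ∈ₑ f ⊎ b ∈ₑ f
  shareEnd-end a≢b ag bg (z , zf , zg) with end-cases a≢b ag bg zg
  ... | inj₁ refl = inj₁ zf
  ... | inj₂ refl = inj₂ zf

  OnlyEdges : Fin n → Fin m → Fin m → Set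
  OnlyEdges a f g = ∀ h → a ∈ₑ h → h ≡ f ⊎ h ≡ g

  third-edge-or-only : ∀ a f g → (∃ λ h → a ∈ₑ h × h ≢ f × h ≢ g) ⊎ OnlyEdges a f g
  third-edge-or-only a f g with any? (λ h → incident? G a h ×-dec ¬? (h ≟ f) ×-dec ¬? (h ≟ g))
  ... | yes third = inj₁ third
  ... | no ∄third = inj₂ only
    where
    only : OnlyEdges a f g
    only h ah with h ≟ f | h ≟ g
    ... | yes h≡f | _       = inj₁ h≡f
    ... | no  _   | yes h≡g = inj₂ h≡g
    ... | no  h≢f | no  h≢g = contradiction (h , ah , h≢f , h≢g) ∄third

  deg≢1 : ∀ {a f g} → a ∈ₑ f → a ∈ₑ g → f ≢ g → deg G a ≢ 1
  deg≢1 {a} af ag f≢g deg≡1 =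
    contradiction (subst (2 ≤ℕ_) deg≡1 (count-≥ (incident? G a) ((f≢g ∷ []) ∷ [] ∷ []) (af ∷ ag ∷ [])))
                  λ { (s≤s ()) }

  deg≡2⇒onlyEdges : ∀ {a f g} → deg G a ≡ 2 → a ∈ₑ f → a ∈ₑ g → f ≢ g → OnlyEdges a f g
  deg≡2⇒onlyEdges {a} {f} {g} deg≡2 af ag f≢g with third-edge-or-only a f g
  ... | inj₂ only = only
  ... | inj₁ (h , ah , h≢f , h≢g) =
    contradiction (subst (3 ≤ℕ_) deg≡2 (count-≥ (incident? G a) distinct (af ∷ ag ∷ ah ∷ [])))
                  λ { (s≤s (s≤s ())) }
    where distinct = (f≢g ∷ ≢-sym h≢f ∷ []) ∷ (≢-sym h≢g ∷ []) ∷ [] ∷ []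

  onlyEdges⇒deg≡2 : ∀ {a f g} → a ∈ₑ f → a ∈ₑ g → f ≢ g → OnlyEdges a f g → deg G a ≡ 2
  onlyEdges⇒deg≡2 {a} af ag f≢g only = count-≡ (incident? G a) ((f≢g ∷ []) ∷ [] ∷ []) (af ∷ ag ∷ [])
                                                λ h ah → [ here , there ∘ here ]′ (only h ah)

  other-edge : ∀ {a f} → a ∈ₑ f → deg G a ≢ 1 → ∃ λ g → a ∈ₑ g × g ≢ f
  other-edge {a} {f} af d≢1 with any? (λ g → incident? G a g ×-dec ¬? (g ≟ f))
  ... | yes other = other
  ... | no ∄other = contradiction (count-≡ (incident? G a) ([] ∷ []) (af ∷ []) only-f) d≢1
    where
    only-f : ∀ g → a ∈ₑ g → g ∈ₗ f ∷ []
    only-f g ag = here (decidable-stable (g ≟ f) λ g≢f → ∄other (g , ag , g≢f))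

  common-neighbour : ∀ {a b} → commonNeighbours G a b ≡ 1 → ∃ λ w → Adj G a w × Adj G b w
  common-neighbour {a} {b} cn≡1 =
    count≢0⇒∃ (λ w → adj? G a w ×-dec adj? G b w) λ cn≡0 → contradiction (trans (sym cn≡1) cn≡0) λ ()

  unique-common-neighbour : ∀ {a b w} → Adj G a w → Adj G b w → (∀ z → Adj G a z → Adj G b z → z ≡ w) →
                            commonNeighbours G a b ≡ 1
  unique-common-neighbour {a} {b} aw bw unique = count-≡ (λ w → adj? G a w ×-dec adj? G b w)
    ([] ∷ []) ((aw , bw) ∷ []) λ z (az , bz) → here (unique z az bz)

  neighbour-on-other-edge : ∀ {a b e x w} → a ≢ b → a ∈ₑ e → b ∈ₑ e → OnlyEdges a e x →
                            Adj G a w → w ≢ b → w ∈ₑ x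
  neighbour-on-other-edge a≢b ae be only aw w≢b with Adj⇒edge aw
  ... | g , ag , wg with only g ag
  ... | inj₂ refl = wg
  ... | inj₁ refl with end-cases a≢b ae be wg
  ...   | inj₁ w≡a = contradiction (sym w≡a) (Adj⇒≢ aw)
  ...   | inj₂ w≡b = contradiction w≡b w≢b

  matching⇒¬shareEnd : ∀ {K f g} → IsMatching G K → f ∈ K → g ∈ K → f ≢ g → ¬ ShareEnd f g
  matching⇒¬shareEnd mK f∈K g∈K f≢g (v , vf , vg) = mK _ _ f∈K g∈K f≢g v vf vg

  ⊆-matching : ∀ {K L} → K ⊆ L → IsMatching G L → IsMatching G K
  ⊆-matching K⊆L mL f g f∈K g∈K = mL f g (K⊆L f∈K) (K⊆L g∈K)

  ∅-matching : IsMatching G ∅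
  ∅-matching _ _ f∈∅ = contradiction f∈∅ ∉⊥

  ⁅⁆-matching : ∀ f → IsMatching G ⁅ f ⁆
  ⁅⁆-matching f g h g∈ h∈ g≢h = contradiction (trans (x∈⁅y⁆⇒x≡y f g∈) (sym (x∈⁅y⁆⇒x≡y f h∈))) g≢h

  ∈-pair : ∀ {f g h : Fin m} → h ∈ ⁅ f ⁆ ∪ ⁅ g ⁆ → h ≡ f ⊎ h ≡ g
  ∈-pair {f} {g} h∈ = Data.Sum.map (x∈⁅y⁆⇒x≡y f) (x∈⁅y⁆⇒x≡y g) (x∈p∪q⁻ ⁅ f ⁆ ⁅ g ⁆ h∈)

  pair-matching : ∀ {f g} → ¬ ShareEnd f g → IsMatching G (⁅ f ⁆ ∪ ⁅ g ⁆)
  pair-matching f∥g h h′ h∈ h′∈ h≢h′ v vh vh′ with ∈-pair h∈ | ∈-pair h′∈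
  ... | inj₁ refl | inj₁ refl = h≢h′ refl
  ... | inj₁ refl | inj₂ refl = f∥g (v , vh , vh′)
  ... | inj₂ refl | inj₁ refl = f∥g (v , vh′ , vh)
  ... | inj₂ refl | inj₂ refl = h≢h′ refl

  -- The skeleton of the matching polytope

  dominated⇒weight≤ : ∀ {c K R} → (∀ i → Dominates c K R i) → weight G c K ≤ weight G c R
  dominated⇒weight≤ K≼R = sumℚ-mono-≤ (dominates⇒term≤ _ ∘ K≼R) (allFin m)

  dominated∧weight≡⇒≡ : ∀ {c K R} → (∀ i → Dominates c K R i) → weight G c K ≡ weight G c R → K ≡ R
  dominated∧weight≡⇒≡ K≼R eq = Subset-ext λ i → dominates∧term≡⇒lookup≡ _ (K≼R i)
    (sumℚ-mono-≤-≡⇒≡ (dominates⇒term≤ _ ∘ K≼R) (allFin m) eq (∈-allFin i))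

  skeletonAdj-by-dominance :
    ∀ {M N} c → IsMatching G M → IsMatching G N → M ≢ N → weight G c N ≡ weight G c M →
    (∀ K → IsMatching G K → (∀ i → Dominates c K M i) ⊎ (∀ i → Dominates c K N i)) →
    SkeletonAdj G M N
  skeletonAdj-by-dominance {M} {N} c mM mN M≢N tie dominated =
    mM , mN , M≢N , c , maximal , tie , ties
    where
    maximal : ∀ K → IsMatching G K → weight G c K ≤ weight G c M
    maximal K mK with dominated K mK
    ... | inj₁ K≼M = dominated⇒weight≤ K≼M
    ... | inj₂ K≼N = ≤-trans (dominated⇒weight≤ K≼N) (≤-reflexive tie)
    ties : ∀ K → IsMatching G K → weight G c K ≡ weight G c M → K ≡ M ⊎ K ≡ N
    ties K mK eq with dominated K mK
    ... | inj₁ K≼M = inj₁ (dominated∧weight≡⇒≡ K≼M eq)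
    ... | inj₂ K≼N = inj₂ (dominated∧weight≡⇒≡ K≼N (trans eq (sym tie)))

  weight-⁅⁆ : ∀ c f → weight G c ⁅ f ⁆ ≡ c f
  weight-⁅⁆ c f =
    trans (sumℚ-δ (allFin m) (Unique.allFin⁺ m) (∈-allFin f) λ i i≢f → term-∉ c (x≢y⇒x∉⁅y⁆ i≢f))
          (term-∈ c (x∈⁅x⁆ f))

  Exchange : (M N K₁ K₂ : Subset m) → Set
  Exchange M N K₁ K₂ = ∀ i → lookup K₁ i ≡ lookup M i × lookup K₂ i ≡ lookup N i
                           ⊎ lookup K₁ i ≡ lookup N i × lookup K₂ i ≡ lookup M i

  exchange-weight : ∀ {M N K₁ K₂} c → Exchange M N K₁ K₂ →
                    weight G c K₁ + weight G c K₂ ≡ weight G c M + weight G c N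
  exchange-weight {M} {N} {K₁} {K₂} c exchange = begin
    weight G c K₁ + weight G c K₂                        ≡⟨ sumℚ-+ (term c K₁) (term c K₂) (allFin m) ⟨
    sumℚ (λ i → term c K₁ i + term c K₂ i) (allFin m)   ≡⟨ sumℚ-cong termwise (allFin m) ⟩
    sumℚ (λ i → term c M i + term c N i) (allFin m)     ≡⟨ sumℚ-+ (term c M) (term c N) (allFin m) ⟩
    weight G c M + weight G c N                          ∎
    where
    open ≡-Reasoning
    at : ∀ {i} K L → lookup K i ≡ lookup L i → term c K i ≡ term c L i
    at _ _ = cong (λ b → if b then _ else 0ℚ)
    termwise : ∀ i → term c K₁ i + term c K₂ i ≡ term c M i + term c N i
    termwise i with exchange i
    ... | inj₁ (K₁≡M , K₂≡N) = cong₂ _+_ (at K₁ M K₁≡M) (at K₂ N K₂≡N)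
    ... | inj₂ (K₁≡N , K₂≡M) =
      trans (cong₂ _+_ (at K₁ N K₁≡N) (at K₂ M K₂≡M)) (+-comm (term c N i) (term c M i))

  -- χ_K₁ + χ_K₂ = χ_M + χ_N, so if K₁ scored below M under the functional certifying the
  -- edge [χ_M, χ_N], then K₂ would score above M.
  exchange-trivial : ∀ {M N K₁ K₂} → SkeletonAdj G M N → IsMatching G K₁ → IsMatching G K₂ →
                     Exchange M N K₁ K₂ → K₁ ≡ M ⊎ K₁ ≡ N
  exchange-trivial {M} {N} {K₁} {K₂} (_ , _ , _ , c , maximal , tie , ties) mK₁ mK₂ exchange =
    ties K₁ mK₁ (≤-antisym (maximal K₁ mK₁) (≮⇒≥ K₁≮M))
    where
    K₁≮M : ¬ (weight G c K₁ < weight G c M)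
    K₁≮M K₁<M = <-irrefl (trans (exchange-weight {M} {N} {K₁} {K₂} c exchange) (cong (weight G c M +_) tie))
                         (+-mono-<-≤ K₁<M (maximal K₂ mK₂))

  insert-adjacent : ∀ {M f} → IsMatching G (M ∪ ⁅ f ⁆) → f ∉ M → SkeletonAdj G M (M ∪ ⁅ f ⁆)
  insert-adjacent {M} {f} mM+f f∉M =
    skeletonAdj-by-dominance c (⊆-matching (p⊆p∪q ⁅ f ⁆) mM+f) mM+f M≢M+f tie dominated
    where
    M+f = M ∪ ⁅ f ⁆
    c = layered M 1ℚ ⁅ f ⁆ 0ℚ

    f∈M+f : f ∈ M+f
    f∈M+f = q⊆p∪q M ⁅ f ⁆ (x∈⁅x⁆ f)

    ∉M+f : ∀ {i} → i ∉ M → i ∉ ⁅ f ⁆ → i ∉ M+f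
    ∉M+f i∉M i∉f = [ i∉M , i∉f ]′ ∘ x∈p∪q⁻ M ⁅ f ⁆

    M≢M+f : M ≢ M+f
    M≢M+f M≡M+f = f∉M (subst (f ∈_) (sym M≡M+f) f∈M+f)

    tie : weight G c M+f ≡ weight G c M
    tie = sumℚ-cong same-term (allFin m)
      where
      same-term : ∀ i → term c M+f i ≡ term c M i
      same-term i with i ∈? M | i ∈? ⁅ f ⁆
      ... | yes i∈M | _       = trans (term-∈ c (p⊆p∪q ⁅ f ⁆ i∈M)) (sym (term-∈ c i∈M))
      ... | no  i∉M | yes i∈f = trans (term-∈ c (q⊆p∪q M ⁅ f ⁆ i∈f))
                                      (trans (layered-∈₂ M 1ℚ ⁅ f ⁆ 0ℚ i∉M i∈f) (sym (term-∉ c i∉M)))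
      ... | no  i∉M | no  i∉f = trans (term-∉ c (∉M+f i∉M i∉f)) (sym (term-∉ c i∉M))

    dominates : ∀ K R → M ⊆ R → R ⊆ M+f → lookup K f ≡ lookup R f → ∀ i → Dominates c K R i
    dominates K R M⊆R R⊆M+f K≡R-at-f i with i ∈? M | i ∈? ⁅ f ⁆
    ... | yes i∈M | _       = take (M⊆R i∈M) (subst (0ℚ <_) (sym (layered-∈₁ M 1ℚ ⁅ f ⁆ 0ℚ i∈M))
                                                     (positive⁻¹ 1ℚ))
    ... | no  i∉M | yes i∈f = agree (subst (λ j → lookup K j ≡ lookup R j) (sym (x∈⁅y⁆⇒x≡y f i∈f)) K≡R-at-f)
    ... | no  i∉M | no  i∉f = drop (∉M+f i∉M i∉f ∘ R⊆M+f) (layered-∉ M 1ℚ ⁅ f ⁆ 0ℚ i∉M i∉f)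

    dominated : ∀ K → IsMatching G K → (∀ i → Dominates c K M i) ⊎ (∀ i → Dominates c K M+f i)
    dominated K _ with f ∈? K
    ... | yes f∈K = inj₂ (dominates K M+f (p⊆p∪q ⁅ f ⁆) id (lookup-∈∈ f∈K f∈M+f))
    ... | no  f∉K = inj₁ (dominates K M id (p⊆p∪q ⁅ f ⁆) (lookup-∉∉ f∉K f∉M))

  skeletonDegree-≥ : ∀ {M k L} → SkeletonDegree G M k → Unique L → (∀ {N} → N ∈ₗ L → SkeletonAdj G M N) →
                     length L ≤ℕ k
  skeletonDegree-≥ (L′ , _ , length-L′ , L′⇔adj) !L adjs = subst (_ ≤ℕ_) length-L′
    (Unique⇒length≤ (≡-dec Bool._≟_) !L λ {N} N∈L → Equivalence.from (L′⇔adj N) (adjs N∈L))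

  module _ (e : Fin m) where

    private
      u v : Fin n
      u = proj₁ (ends e)
      v = proj₂ (ends e)

      u∈e : u ∈ₑ e
      u∈e = inj₁ refl

      v∈e : v ∈ₑ e
      v∈e = inj₂ refl

      u≢v : u ≢ v
      u≢v = noLoop e

    CrossPair : Fin m → Fin m → Set
    CrossPair x y = u ∈ₑ x × v ∈ₑ y × x ≢ e × y ≢ e × ¬ ShareEnd x y

    crossPair⇒¬bondOrPendant : ∀ {x y} → CrossPair x y → ¬ (Bond G e ⊎ Pendant G e)
    crossPair⇒¬bondOrPendant (ux , vy , x≢e , y≢e , x∥y) =
      [ ¬bond , [ deg≢1 u∈e ux (≢-sym x≢e) , deg≢1 v∈e vy (≢-sym y≢e) ]′ ]′
      where
      ¬bond : ¬ Bond G e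
      ¬bond (du , dv , cn) with common-neighbour cn
      ... | w , uw , vw = x∥y (w , wx , wy)
        where
        wx = neighbour-on-other-edge u≢v u∈e v∈e (deg≡2⇒onlyEdges du u∈e ux (≢-sym x≢e))
                                     uw (≢-sym (Adj⇒≢ vw))
        wy = neighbour-on-other-edge (≢-sym u≢v) v∈e u∈e (deg≡2⇒onlyEdges dv v∈e vy (≢-sym y≢e))
                                     vw (≢-sym (Adj⇒≢ uw))

    triangle⇒crossPair : ¬ Bond G e → ∀ {x y w} → u ≢ w → v ≢ w →
                         u ∈ₑ x → w ∈ₑ x → v ∈ₑ y → w ∈ₑ y → x ≢ e → y ≢ e → ∃₂ CrossPair
    triangle⇒crossPair ¬bond {x} {y} {w} u≢w v≢w ux wx vy wy x≢e y≢e
      with third-edge-or-only u e x | third-edge-or-only v e y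
    ... | inj₁ (x′ , ux′ , x′≢e , x′≢x) | _ = x′ , y , ux′ , vy , x′≢e , y≢e , x′∥y
      where
      x′∥y : ¬ ShareEnd x′ y
      x′∥y = [ (λ vx′ → x′≢e (edge-unique u≢v ux′ vx′ u∈e v∈e))
             , (λ wx′ → x′≢x (edge-unique u≢w ux′ wx′ ux wx)) ]′ ∘ shareEnd-end v≢w vy wy
    ... | inj₂ _ | inj₁ (y′ , vy′ , y′≢e , y′≢y) = x , y′ , ux , vy′ , x≢e , y′≢e , x∥y′
      where
      x∥y′ : ¬ ShareEnd x y′
      x∥y′ = [ (λ uy′ → y′≢e (edge-unique u≢v uy′ vy′ u∈e v∈e))
             , (λ wy′ → y′≢y (edge-unique v≢w vy′ wy′ vy wy)) ]′ ∘ shareEnd-end u≢w ux wx ∘ shareEnd-sym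
    ... | inj₂ onlyU | inj₂ onlyV = contradiction (du , dv , cn) ¬bond
      where
      du = onlyEdges⇒deg≡2 u∈e ux (≢-sym x≢e) onlyU
      dv = onlyEdges⇒deg≡2 v∈e vy (≢-sym y≢e) onlyV
      onlyW : ∀ z → Adj G u z → Adj G v z → z ≡ w
      onlyW z uz vz with end-cases u≢w ux wx (neighbour-on-other-edge u≢v u∈e v∈e onlyU uz (≢-sym (Adj⇒≢ vz)))
      ... | inj₁ z≡u = contradiction (sym z≡u) (Adj⇒≢ uz)
      ... | inj₂ z≡w = z≡w
      cn = unique-common-neighbour (edge⇒Adj u≢w ux wx) (edge⇒Adj v≢w vy wy) onlyW

    ¬bondOrPendant⇒crossPair : ¬ (Bond G e ⊎ Pendant G e) → ∃₂ CrossPair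
    ¬bondOrPendant⇒crossPair ¬bp with other-edge u∈e (¬bp ∘ inj₂ ∘ inj₁) | other-edge v∈e (¬bp ∘ inj₂ ∘ inj₂)
    ... | x , ux , x≢e | y , vy , y≢e with shareEnd? x y
    ... | no  x∥y           = x , y , ux , vy , x≢e , y≢e , x∥y
    ... | yes (w , wx , wy) = triangle⇒crossPair (¬bp ∘ inj₁) u≢w v≢w ux wx vy wy x≢e y≢e
      where
      u≢w : u ≢ w
      u≢w refl = y≢e (edge-unique u≢v wy vy u∈e v∈e)
      v≢w : v ≢ w
      v≢w refl = x≢e (edge-unique u≢v ux wx u∈e v∈e)

    orient : ∀ {x y} → x ≢ e → y ≢ e → ShareEnd e x → ShareEnd e y → ¬ ShareEnd x y →
             CrossPair x y ⊎ CrossPair y x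
    orient x≢e y≢e (_ , inj₁ refl , ux) (_ , inj₁ refl , uy) x∥y = contradiction (_ , ux , uy) x∥y
    orient x≢e y≢e (_ , inj₂ refl , vx) (_ , inj₂ refl , vy) x∥y = contradiction (_ , vx , vy) x∥y
    orient x≢e y≢e (_ , inj₁ refl , ux) (_ , inj₂ refl , vy) x∥y = inj₁ (ux , vy , x≢e , y≢e , x∥y)
    orient x≢e y≢e (_ , inj₂ refl , vx) (_ , inj₁ refl , uy) x∥y =
      inj₂ (uy , vx , y≢e , x≢e , x∥y ∘ shareEnd-sym)

    -- The neighbours of {e}

    star-adjacent : ∀ {N} → IsMatching G N → e ∉ N → (∀ {x} → x ∈ N → ShareEnd e x) →
                    SkeletonAdj G ⁅ e ⁆ N
    star-adjacent {N} mN e∉N meets = skeletonAdj-by-dominance c (⁅⁆-matching e) mN ⁅e⁆≢N tie dominated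
      where
      size = weight G (λ _ → 1ℚ) N
      c = layered ⁅ e ⁆ size N 1ℚ

      ⁅e⁆≢N : ⁅ e ⁆ ≢ N
      ⁅e⁆≢N ⁅e⁆≡N = e∉N (subst (e ∈_) ⁅e⁆≡N (x∈⁅x⁆ e))

      ∈⁅e⁆⇒∉N : ∀ {i} → i ∈ ⁅ e ⁆ → i ∉ N
      ∈⁅e⁆⇒∉N i∈e = e∉N ∘ subst (_∈ N) (x∈⁅y⁆⇒x≡y e i∈e)

      tie : weight G c N ≡ weight G c ⁅ e ⁆
      tie = begin
        weight G c N      ≡⟨ sumℚ-cong unit-on-N (allFin m) ⟩
        size              ≡⟨ layered-∈₁ ⁅ e ⁆ size N 1ℚ (x∈⁅x⁆ e) ⟨
        c e               ≡⟨ weight-⁅⁆ c e ⟨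
        weight G c ⁅ e ⁆  ∎
        where
        open ≡-Reasoning
        unit-on-N : ∀ i → term c N i ≡ term (λ _ → 1ℚ) N i
        unit-on-N i with i ∈? N
        ... | yes i∈N = trans (term-∈ c i∈N) (trans (layered-∈₂ ⁅ e ⁆ size N 1ℚ (λ i∈e → ∈⁅e⁆⇒∉N i∈e i∈N) i∈N)
                                                    (sym (term-∈ _ i∈N)))
        ... | no  i∉N = trans (term-∉ c i∉N) (sym (term-∉ _ i∉N))

      dominated : ∀ K → IsMatching G K → (∀ i → Dominates c K ⁅ e ⁆ i) ⊎ (∀ i → Dominates c K N i)
      dominated K mK with e ∈? K
      ... | yes e∈K = inj₁ ≼⁅e⁆
        where
        ≼⁅e⁆ : ∀ i → Dominates c K ⁅ e ⁆ i
        ≼⁅e⁆ i with i ∈? ⁅ e ⁆ | i ∈? N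
        ... | yes i∈e | _       = agree (lookup-∈∈ (subst (_∈ K) (sym (x∈⁅y⁆⇒x≡y e i∈e)) e∈K) i∈e)
        ... | no  i∉e | yes i∈N = agree (lookup-∉∉ i∉K i∉e)
          where
          i∉K : i ∉ K
          i∉K i∈K = matching⇒¬shareEnd mK e∈K i∈K (λ e≡i → i∉e (subst (_∈ ⁅ e ⁆) e≡i (x∈⁅x⁆ e))) (meets i∈N)
        ... | no  i∉e | no  i∉N = drop i∉e (layered-∉ ⁅ e ⁆ size N 1ℚ i∉e i∉N)
      ... | no  e∉K = inj₂ ≼N
        where
        ≼N : ∀ i → Dominates c K N i
        ≼N i with i ∈? ⁅ e ⁆ | i ∈? N
        ... | yes i∈e | _       = agree (lookup-∉∉ (e∉K ∘ subst (_∈ K) (x∈⁅y⁆⇒x≡y e i∈e)) (∈⁅e⁆⇒∉N i∈e))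
        ... | no  i∉e | yes i∈N = take i∈N (subst (0ℚ <_) (sym (layered-∈₂ ⁅ e ⁆ size N 1ℚ i∉e i∈N))
                                                  (positive⁻¹ 1ℚ))
        ... | no  i∉e | no  i∉N = drop i∉N (layered-∉ ⁅ e ⁆ size N 1ℚ i∉e i∉N)

    crossPair-adjacent : ∀ {x y} → CrossPair x y → SkeletonAdj G ⁅ e ⁆ (⁅ x ⁆ ∪ ⁅ y ⁆)
    crossPair-adjacent {x} {y} (ux , vy , x≢e , y≢e , x∥y) =
      star-adjacent (pair-matching x∥y) ([ x≢e ∘ sym , y≢e ∘ sym ]′ ∘ ∈-pair) meets
      where
      meets : ∀ {z} → z ∈ ⁅ x ⁆ ∪ ⁅ y ⁆ → ShareEnd e z
      meets z∈ with ∈-pair z∈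
      ... | inj₁ refl = u , u∈e , ux
      ... | inj₂ refl = v , v∈e , vy

    partner : Fin m → Subset m
    partner f with f ≟ e | shareEnd? e f
    ... | yes _ | _     = ∅
    ... | no  _ | yes _ = ⁅ f ⁆
    ... | no  _ | no  _ = ⁅ e ⁆ ∪ ⁅ f ⁆

    partner-adjacent : ∀ f → SkeletonAdj G ⁅ e ⁆ (partner f)
    partner-adjacent f with f ≟ e | shareEnd? e f
    ... | yes _   | _       = star-adjacent ∅-matching ∉⊥ λ x∈∅ → contradiction x∈∅ ∉⊥
    ... | no  f≢e | yes e~f = star-adjacent (⁅⁆-matching f) (f≢e ∘ sym ∘ x∈⁅y⁆⇒x≡y f)
                                            λ x∈f → subst (ShareEnd e) (sym (x∈⁅y⁆⇒x≡y f x∈f)) e~f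
    ... | no  f≢e | no  e∥f = insert-adjacent (pair-matching e∥f) (f≢e ∘ x∈⁅y⁆⇒x≡y e)

    partner-∅ : partner e ≡ ∅
    partner-∅ with e ≟ e
    ... | yes _   = refl
    ... | no  e≢e = contradiction refl e≢e

    partner-meeting : ∀ {f} → f ≢ e → ShareEnd e f → partner f ≡ ⁅ f ⁆
    partner-meeting {f} f≢e e~f with f ≟ e | shareEnd? e f
    ... | yes f≡e | _       = contradiction f≡e f≢e
    ... | no  _   | yes _   = refl
    ... | no  _   | no  e∥f = contradiction e~f e∥f

    partner-disjoint : ∀ {f} → ¬ ShareEnd e f → partner f ≡ ⁅ e ⁆ ∪ ⁅ f ⁆
    partner-disjoint {f} e∥f with f ≟ e | shareEnd? e f
    ... | yes refl | _       = contradiction (shareEnd-refl e) e∥f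
    ... | no  _    | yes e~f = contradiction e~f e∥f
    ... | no  _    | no  _   = refl

    ∈-partner : ∀ {f g} → g ∈ partner f → g ≢ e → g ≡ f
    ∈-partner {f} g∈ g≢e with f ≟ e | shareEnd? e f
    ... | yes _ | _     = contradiction g∈ ∉⊥
    ... | no  _ | yes _ = x∈⁅y⁆⇒x≡y f g∈
    ... | no  _ | no  _ = [ (λ g≡e → contradiction g≡e g≢e) , id ]′ (∈-pair g∈)

    partner-∋ : ∀ {f} → f ≢ e → f ∈ partner f
    partner-∋ {f} f≢e with f ≟ e | shareEnd? e f
    ... | yes f≡e | _     = contradiction f≡e f≢e
    ... | no  _   | yes _ = x∈⁅x⁆ f
    ... | no  _   | no  _ = q⊆p∪q ⁅ e ⁆ ⁅ f ⁆ (x∈⁅x⁆ f)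

    partner-injective : ∀ {f g} → partner f ≡ partner g → f ≡ g
    partner-injective {f} {g} eq = by-cases (f ≟ e) (g ≟ e)
      where
      by-cases : Dec (f ≡ e) → Dec (g ≡ e) → f ≡ g
      by-cases (yes f≡e) (yes g≡e) = trans f≡e (sym g≡e)
      by-cases (no  f≢e) _         = ∈-partner (subst (f ∈_) eq (partner-∋ f≢e)) f≢e
      by-cases (yes _)   (no  g≢e) = sym (∈-partner (subst (g ∈_) (sym eq) (partner-∋ g≢e)) g≢e)

    neighbour-with-disjoint-edge : ∀ {N x} → SkeletonAdj G ⁅ e ⁆ N → x ∈ N → ¬ ShareEnd e x →
                                   N ≡ ⁅ e ⁆ ∪ ⁅ x ⁆
    neighbour-with-disjoint-edge {N} {x} adj@(_ , mN , _) x∈N e∥x =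
      [ (λ K₁≡⁅e⁆ → contradiction (subst (x ∈_) K₁≡⁅e⁆ x∈K₁) x∉⁅e⁆) , sym ]′
        (exchange-trivial adj (pair-matching e∥x) (⊆-matching (p─q⊆p N ⁅ x ⁆) mN) exchanged)
      where
      x∉⁅e⁆ : x ∉ ⁅ e ⁆
      x∉⁅e⁆ x∈e = e∥x (subst (ShareEnd e) (sym (x∈⁅y⁆⇒x≡y e x∈e)) (shareEnd-refl e))

      x∈K₁ : x ∈ ⁅ e ⁆ ∪ ⁅ x ⁆
      x∈K₁ = q⊆p∪q ⁅ e ⁆ ⁅ x ⁆ (x∈⁅x⁆ x)

      exchanged : Exchange ⁅ e ⁆ N (⁅ e ⁆ ∪ ⁅ x ⁆) (N - x)
      exchanged i with i ≟ x
      ... | yes refl = inj₂ (lookup-∈∈ x∈K₁ x∈N , lookup-∉∉ (x∉p-x N x) x∉⁅e⁆)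
      ... | no  i≢x  = inj₁ ( lookup-≡ i K₁⇒⁅e⁆ (p⊆p∪q ⁅ x ⁆)
                            , lookup-≡ i (p─q⊆p N ⁅ x ⁆) (λ i∈N → x∈p∧x≢y⇒x∈p-y i∈N i≢x))
        where
        K₁⇒⁅e⁆ : i ∈ ⁅ e ⁆ ∪ ⁅ x ⁆ → i ∈ ⁅ e ⁆
        K₁⇒⁅e⁆ = [ id , (λ i∈x → contradiction (x∈⁅y⁆⇒x≡y x i∈x) i≢x) ]′ ∘ x∈p∪q⁻ ⁅ e ⁆ ⁅ x ⁆

    neighbour-is-partner : (∀ {x y} → ¬ CrossPair x y) → ∀ {N} → SkeletonAdj G ⁅ e ⁆ N →
                           ∃ λ f → N ≡ partner f
    neighbour-is-partner no-cross {N} adj@(_ , mN , ⁅e⁆≢N , _)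
      with any? (λ x → x ∈? N ×-dec ¬? (shareEnd? e x))
    ... | yes (x , x∈N , e∥x) =
      x , trans (neighbour-with-disjoint-edge adj x∈N e∥x) (sym (partner-disjoint e∥x))
    ... | no  ∄disjoint = all-meet (nonempty? N)
      where
      meets : ∀ {y} → y ∈ N → ShareEnd e y
      meets {y} y∈N = decidable-stable (shareEnd? e y) λ e∥y → ∄disjoint (y , y∈N , e∥y)

      e∉N : e ∉ N
      e∉N e∈N = ⁅e⁆≢N (sym (≡⁅⁆ e∈N λ y∈N y≢e → matching⇒¬shareEnd mN e∈N y∈N (≢-sym y≢e) (meets y∈N)))

      ∈N⇒≢e : ∀ {y} → y ∈ N → y ≢ e
      ∈N⇒≢e y∈N refl = e∉N y∈N

      all-meet : Dec (∃ (_∈ N)) → ∃ λ f → N ≡ partner f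
      all-meet (no  N-empty)   = e , trans (Empty-unique N-empty) (sym partner-∅)
      all-meet (yes (x , x∈N)) = x , trans (≡⁅⁆ x∈N only-x) (sym (partner-meeting (∈N⇒≢e x∈N) (meets x∈N)))
        where
        only-x : ∀ {y} → y ∈ N → ¬ y ≢ x
        only-x y∈N y≢x = [ no-cross , no-cross ]′ (orient (∈N⇒≢e x∈N) (∈N⇒≢e y∈N) (meets x∈N) (meets y∈N)
                                                          (matching⇒¬shareEnd mN x∈N y∈N (≢-sym y≢x)))

    partners : List (Subset m)
    partners = map partner (allFin m)

    partners-unique : Unique partners
    partners-unique = Unique.map⁺ partner-injective (Unique.allFin⁺ m)

    length-partners : length partners ≡ m
    length-partners = trans (length-map partner (allFin m)) (length-tabulate id)

    ∈partners⇒adjacent : ∀ {N} → N ∈ₗ partners → SkeletonAdj G ⁅ e ⁆ N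
    ∈partners⇒adjacent N∈ with ∈-map⁻ partner N∈
    ... | f , _ , refl = partner-adjacent f

    adjacent⇒∈partners : (∀ {x y} → ¬ CrossPair x y) → ∀ {N} → SkeletonAdj G ⁅ e ⁆ N → N ∈ₗ partners
    adjacent⇒∈partners no-cross adj with neighbour-is-partner no-cross adj
    ... | f , refl = ∈-map⁺ partner (∈-allFin f)

    crossPair∉partners : ∀ {x y} → CrossPair x y → All (⁅ x ⁆ ∪ ⁅ y ⁆ ≢_) partners
    crossPair∉partners {x} {y} (_ , _ , x≢e , y≢e , x∥y) =
      All.tabulate λ N∈ eq → x∥y (subst (ShareEnd x) (x≡y N∈ eq) (shareEnd-refl x))
      where
      x≡y : ∀ {N} → N ∈ₗ partners → ⁅ x ⁆ ∪ ⁅ y ⁆ ≡ N → x ≡ y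
      x≡y N∈ eq with ∈-map⁻ partner N∈
      ... | f , _ , refl = trans (∈-partner {f} (subst (x ∈_) eq (p⊆p∪q ⁅ y ⁆ (x∈⁅x⁆ x))) x≢e)
                                 (sym (∈-partner {f} (subst (y ∈_) eq (q⊆p∪q ⁅ x ⁆ ⁅ y ⁆ (x∈⁅x⁆ y))) y≢e))

    bondOrPendant? : Dec (Bond G e ⊎ Pendant G e)
    bondOrPendant? = (deg G u ℕ.≟ 2 ×-dec deg G v ℕ.≟ 2 ×-dec commonNeighbours G u v ℕ.≟ 1)
                     ⊎-dec (deg G u ℕ.≟ 1 ⊎-dec deg G v ℕ.≟ 1)

proposition3p4 : (n m : ℕ) (G : Graph n m) (e : Fin m) →
    SkeletonDegree G ⁅ e ⁆ m ⇔ (Bond G e ⊎ Pendant G e)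
proposition3p4 n m G e = mk⇔ forward backward
  where
  forward : SkeletonDegree G ⁅ e ⁆ m → Bond G e ⊎ Pendant G e
  forward degree = decidable-stable (bondOrPendant? G e) λ ¬bp →
    let x , y , cross = ¬bondOrPendant⇒crossPair G e ¬bp
        adjacent : ∀ {N} → N ∈ₗ (⁅ x ⁆ ∪ ⁅ y ⁆) ∷ partners G e → SkeletonAdj G ⁅ e ⁆ N
        adjacent = λ { (here refl) → crossPair-adjacent G e cross ; (there N∈) → ∈partners⇒adjacent G e N∈ }
    in ℕ.<-irrefl (length-partners G e)
                  (skeletonDegree-≥ G degree (crossPair∉partners G e cross ∷ partners-unique G e) adjacent)

  backward : Bond G e ⊎ Pendant G e → SkeletonDegree G ⁅ e ⁆ m
  backward bp = partners G e , partners-unique G e , length-partners G e , λ N →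
    mk⇔ (∈partners⇒adjacent G e) (adjacent⇒∈partners G e λ cross → crossPair⇒¬bondOrPendant G e cross bp)
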